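{- Let $P$ be a finite poset with connected components $P_1,\dots,P_r$. Then the poset polytope of $P$ is the free sum of the poset polytopes of its components: \[ \mathbf{H}_P=\mathbf{H}_{P_1}\oplus\cdots\oplus\mathbf{H}_{P_r}, \] where $\mathbf{H}_{P_i}$ is regarded inside the coordinate subspace of $\mathbb{Q}^m$ spanned by the basis vectors indexed by the elements of $P_i$.
   Context: Let $P=\{\varepsilon_1,\dots,\varepsilon_m\}$ be a finite poset and $e_1,\dots,e_m$ the standard basis of $\mathbb{Q}^m$ (indexed by the elements of $P$). Let $\hat P=P\cup\{\hat0,\hat1\}$ with $\hat0$ below and $\hat1$ above every element of $P$. For each cover relation $a\lessdot b$ in $\hat P$ define $\rho(a,b)=e_i$ if $a=\varepsilon_i$ and $b=\hat1$; $\rho(a,b)=e_i-e_j$ if $a=\varepsilon_i,\ b=\varepsilon_j\in P$; $\rho(a,b)=-e_j$ if $a=\hat0$ and $b=\varepsilon_j$. The poset polytope $\mathbf{H}_P$ is the convex hull of all $\rho(a,b)$ over cover relations $a\lessdot b$ of $\hat P$. A poset is connected if its Hasse diagram is connected. For polytopes $\mathbf{Q}\subset\mathbb{Q}^a$, $\mathbf{P}\subset\mathbb{Q}^b$ each containing the origin, the free sum is $\mathbf{Q}\oplus\mathbf{P}=\mathrm{conv}(\mathbf{Q}\times\{0\}\cup\{0\}\times\mathbf{P})\subset\mathbb{Q}^{a+b}$ (iterated for several summands). -}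

module Defs where

open import Data.Nat using (ℕ; zero; suc)
open import Data.Fin using (Fin; zero; suc; _≟_)
open import Data.Rational using (ℚ; 0ℚ; 1ℚ; _+_; _*_; -_; _-_; _≤_)
open import Data.Product using (Σ; ∃; ∃-syntax; _×_; _,_)
open import Data.Sum using (_⊎_)
open import Data.Unit using (⊤)
open import Data.Empty using (⊥)
open import Data.Maybe using (Maybe; just; nothing)
open import Relation.Nullary using (¬_; yes; no)
open import Relation.Binary.PropositionalEquality using (_≡_; _≢_)
open import Relation.Binary.Structures using (IsPartialOrder)
open import Relation.Binary.Construct.Closure.Equivalence using (EqClosure)

-- Vectors in ℚ^m (coordinates indexed by the elements of P = Fin m)

Vecℚ : ℕ → Set
Vecℚ m = Fin m → ℚ

_≈_ : ∀ {m} → Vecℚ m → Vecℚ m → Set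
x ≈ y = ∀ i → x i ≡ y i

Subset : ℕ → Set₁
Subset m = Vecℚ m → Set

_≐_ : ∀ {m} → Subset m → Subset m → Set
A ≐ B = ∀ x → (A x → B x) × (B x → A x)

Σℚ : ∀ n → (Fin n → ℚ) → ℚ
Σℚ zero    f = 0ℚ
Σℚ (suc n) f = f zero + Σℚ n (λ i → f (suc i))

e : ∀ {m} → Fin m → Vecℚ m
e i j with i ≟ j
... | yes _ = 1ℚ
... | no  _ = 0ℚ

Conv : ∀ {m} → Subset m → Subset m
Conv {m} S x =
  ∃[ n ] Σ (Fin n → Vecℚ m) λ pts → Σ (Fin n → ℚ) λ w →
    (∀ k → S (pts k)) × (∀ k → 0ℚ ≤ w k) × (Σℚ n w ≡ 1ℚ) ×
    (x ≈ (λ j → Σℚ n (λ k → w k * pts k j)))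

-- Free sum of a family of polytopes Q_1,…,Q_r, each already regarded
-- inside (its coordinate subspace of) ℚ^m: the convex hull of their union.
FreeSum : ∀ {m r} → (Fin r → Subset m) → Subset m
FreeSum {r = r} Q = Conv (λ x → ∃[ k ] Q k x)

module PosetPolytope {m : ℕ} (_≼_ : Fin m → Fin m → Set) where

  _≺_ : Fin m → Fin m → Set
  i ≺ j = i ≼ j × i ≢ j

  -- elements of P̂ = P ∪ {0̂, 1̂}
  data Hat : Set where
    bot : Hat
    el  : Fin m → Hat
    top : Hat

  _<̂_ : Hat → Hat → Set
  bot  <̂ bot  = ⊥
  bot  <̂ el j = ⊤
  bot  <̂ top  = ⊤
  el i <̂ bot  = ⊥
  el i <̂ el j = i ≺ j
  el i <̂ top  = ⊤
  top  <̂ _    = ⊥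

  -- For a subposet S ⊆ P (induced order), membership in Ŝ = S ∪ {0̂,1̂}
  InHat : (Fin m → Set) → Hat → Set
  InHat S bot    = ⊤
  InHat S (el i) = S i
  InHat S top    = ⊤

  Cover : (Fin m → Set) → Hat → Hat → Set
  Cover S a b = InHat S a × InHat S b × a <̂ b ×
                (∀ c → InHat S c → ¬ (a <̂ c × c <̂ b))

  ρ : Hat → Hat → Maybe (Vecℚ m)
  ρ (el i) top    = just (e i)
  ρ (el i) (el j) = just (λ k → e i k - e j k)
  ρ bot    (el j) = just (λ k → - e j k)
  ρ _      _      = nothing

  Gen : (Fin m → Set) → Subset m
  Gen S v = ∃[ a ] ∃[ b ] Σ (Vecℚ m) λ w →
              Cover S a b × ρ a b ≡ just w × v ≈ w

  -- poset polytope H_S of the induced subposet S, inside ℚ^m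
  -- (i.e. in the coordinate subspace spanned by the e_i, i ∈ S)
  H : (Fin m → Set) → Subset m
  H S = Conv (Gen S)

  H-P : Subset m
  H-P = H (λ _ → ⊤)

  CoverP : Fin m → Fin m → Set
  CoverP i j = Cover (λ _ → ⊤) (el i) (el j)

  Connected : Fin m → Fin m → Set
  Connected = EqClosure CoverP

  -- c : P → Fin r labels the connected components P_1,…,P_r of P
  -- (c surjective, and c i ≡ c j iff i and j are connected)
  IsComponentLabelling : (r : ℕ) → (Fin m → Fin r) → Set
  IsComponentLabelling r c =
    (∀ k → ∃[ i ] c i ≡ k) ×
    (∀ i j → (c i ≡ c j → Connected i j) × (Connected i j → c i ≡ c j))

-- Every cover relation of P̂ is a cover relation of P̂_k for a single
-- component P_k, and conversely a cover inside a component is a cover of P̂: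
-- comparable elements of P are joined by a chain of covers, hence lie in
-- one component.  So the generators of H_P are exactly the union of the
-- generators of the H_{P_k}, and taking convex hulls commutes with this
-- union because the convex hull is idempotent.
module Submission where

open import Defs
open import Data.Nat using (ℕ; zero; suc) renaming (_+_ to _+ℕ_)
open import Data.Fin using (Fin; zero; suc; splitAt; _≟_)
open import Data.Fin.Induction using (spo-wellFounded)
open import Data.Rational using (ℚ; 0ℚ; 1ℚ; _+_; _*_; _≤_; nonNegative)
open import Data.Rational.Properties
  using (+-identityˡ; +-identityʳ; *-identityˡ; *-identityʳ; *-zeroʳ; *-assoc; +-assoc;
         *-distribˡ-+; nonNegative⁻¹; nonNeg*nonNeg⇒nonNeg)
open import Data.Vec.Functional using (_++_)
open import Data.Product using (Σ; ∃-syntax; _×_; _,_; proj₂)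
open import Data.Sum using (inj₁; inj₂; [_,_]; map)
open import Data.Sum.Properties using ([,]-map)
open import Data.Unit using (⊤; tt)
open import Function using (flip)
open import Induction.WellFounded using (WellFounded; Acc; acc)
open import Relation.Nullary using (¬_; Dec; yes; no)
open import Relation.Nullary.Decidable using (decidable-stable; ¬¬-excluded-middle)
open import Relation.Nullary.Negation using (¬¬-map)
open import Relation.Binary.PropositionalEquality
  using (_≡_; _≗_; refl; sym; trans; cong; cong₂; module ≡-Reasoning)
open import Relation.Binary.Structures using (IsPartialOrder; IsStrictPartialOrder)
open import Relation.Binary.Construct.Closure.Equivalence using (return)
open import Relation.Binary.Construct.Closure.ReflexiveTransitive using (_◅◅_)
import Relation.Binary.Construct.NonStrictToStrict as ToStrict
import Relation.Binary.Construct.Flip.EqAndOrd as Flip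

Σℚ-cong : ∀ n {f g : Fin n → ℚ} → f ≗ g → Σℚ n f ≡ Σℚ n g
Σℚ-cong zero    f≗g = refl
Σℚ-cong (suc n) f≗g = cong₂ _+_ (f≗g zero) (Σℚ-cong n (λ k → f≗g (suc k)))

*-distribˡ-Σℚ : ∀ n a (f : Fin n → ℚ) → a * Σℚ n f ≡ Σℚ n (λ k → a * f k)
*-distribˡ-Σℚ zero    a f = *-zeroʳ a
*-distribˡ-Σℚ (suc n) a f = trans (*-distribˡ-+ a (f zero) _)
                                  (cong (a * f zero +_) (*-distribˡ-Σℚ n a (λ k → f (suc k))))

Σℚ-++ : ∀ n n′ (f : Fin n → ℚ) (g : Fin n′ → ℚ) → Σℚ (n +ℕ n′) (f ++ g) ≡ Σℚ n f + Σℚ n′ g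
Σℚ-++ zero    n′ f g = sym (+-identityˡ _)
Σℚ-++ (suc n) n′ f g = begin
  f zero + Σℚ (n +ℕ n′) (λ k → [ f , g ] (map suc (λ k → k) (splitAt n k)))
    ≡⟨ cong (f zero +_) (Σℚ-cong (n +ℕ n′) (λ k → [,]-map (splitAt n k))) ⟩
  f zero + Σℚ (n +ℕ n′) ((λ k → f (suc k)) ++ g)
    ≡⟨ cong (f zero +_) (Σℚ-++ n n′ (λ k → f (suc k)) g) ⟩
  f zero + (Σℚ n (λ k → f (suc k)) + Σℚ n′ g)
    ≡⟨ sym (+-assoc (f zero) _ _) ⟩
  Σℚ (suc n) f + Σℚ n′ g ∎
  where open ≡-Reasoning

zipWith-++ : ∀ {A B C : Set} {n n′} (h : A → B → C)
  (a : Fin n → A) (a′ : Fin n′ → A) (b : Fin n → B) (b′ : Fin n′ → B) →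
  (λ k → h ((a ++ a′) k) ((b ++ b′) k)) ≗ (λ k → h (a k) (b k)) ++ (λ k → h (a′ k) (b′ k))
zipWith-++ {n = n} h a a′ b b′ k with splitAt n k
... | inj₁ i = refl
... | inj₂ i = refl

All-++ : ∀ {A : Set} (Q : A → Set) {n n′} (f : Fin n → A) (g : Fin n′ → A) →
  (∀ k → Q (f k)) → (∀ k → Q (g k)) → ∀ k → Q ((f ++ g) k)
All-++ Q {n} f g Qf Qg k with splitAt n k
... | inj₁ i = Qf i
... | inj₂ i = Qg i

0≤* : ∀ {a b} → 0ℚ ≤ a → 0ℚ ≤ b → 0ℚ ≤ a * b
0≤* {a} {b} 0≤a 0≤b =
  nonNegative⁻¹ _ {{nonNeg*nonNeg⇒nonNeg a {{nonNegative 0≤a}} b {{nonNegative 0≤b}}}}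

_⊆_ : ∀ {m} → Subset m → Subset m → Set
A ⊆ B = ∀ x → A x → B x

module _ {m : ℕ} (T : Subset m) where

  -- Conv T is definitionally WeightedSum T 1ℚ.
  WeightedSum : ℚ → Subset m
  WeightedSum s x = ∃[ n ] Σ (Fin n → Vecℚ m) λ pts → Σ (Fin n → ℚ) λ w →
    (∀ k → T (pts k)) × (∀ k → 0ℚ ≤ w k) × (Σℚ n w ≡ s) ×
    (x ≈ (λ j → Σℚ n (λ k → w k * pts k j)))

  WeightedSum-resp : ∀ {s s′ x x′} → s ≡ s′ → x ≈ x′ → WeightedSum s x → WeightedSum s′ x′
  WeightedSum-resp s≡s′ x≈x′ (n , pts , w , T-pts , 0≤w , Σw , x≈) =
    n , pts , w , T-pts , 0≤w , trans Σw s≡s′ , λ j → trans (sym (x≈x′ j)) (x≈ j)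

  WeightedSum-zero : WeightedSum 0ℚ (λ _ → 0ℚ)
  WeightedSum-zero = 0 , (λ ()) , (λ ()) , (λ ()) , (λ ()) , refl , λ _ → refl

  WeightedSum-scale : ∀ {s x} a → 0ℚ ≤ a → WeightedSum s x → WeightedSum (a * s) (λ j → a * x j)
  WeightedSum-scale a 0≤a (n , pts , w , T-pts , 0≤w , Σw , x≈) =
    n , pts , (λ k → a * w k) , T-pts , (λ k → 0≤* 0≤a (0≤w k)) ,
    trans (sym (*-distribˡ-Σℚ n a w)) (cong (a *_) Σw) ,
    λ j → trans (cong (a *_) (x≈ j))
      (trans (*-distribˡ-Σℚ n a _) (Σℚ-cong n (λ k → sym (*-assoc a (w k) (pts k j)))))

  WeightedSum-add : ∀ {s s′ x y} → WeightedSum s x → WeightedSum s′ y →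
                    WeightedSum (s + s′) (λ j → x j + y j)
  WeightedSum-add (n , pts , w , T-pts , 0≤w , Σw , x≈)
                  (n′ , pts′ , w′ , T-pts′ , 0≤w′ , Σw′ , y≈) =
    n +ℕ n′ , pts ++ pts′ , w ++ w′ ,
    All-++ T pts pts′ T-pts T-pts′ , All-++ (0ℚ ≤_) w w′ 0≤w 0≤w′ ,
    trans (Σℚ-++ n n′ w w′) (cong₂ _+_ Σw Σw′) ,
    λ j → trans (cong₂ _+_ (x≈ j) (y≈ j))
      (sym (trans (Σℚ-cong (n +ℕ n′) (zipWith-++ (λ a p → a * p j) w w′ pts pts′))
                  (Σℚ-++ n n′ _ _)))

  WeightedSum-of-Conv : ∀ n (pts : Fin n → Vecℚ m) (w : Fin n → ℚ) →
    (∀ k → Conv T (pts k)) → (∀ k → 0ℚ ≤ w k) →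
    WeightedSum (Σℚ n w) (λ j → Σℚ n (λ k → w k * pts k j))
  WeightedSum-of-Conv zero    pts w T-pts 0≤w = WeightedSum-zero
  WeightedSum-of-Conv (suc n) pts w T-pts 0≤w = WeightedSum-add
    (WeightedSum-resp (*-identityʳ (w zero)) (λ _ → refl)
      (WeightedSum-scale (w zero) (0≤w zero) (T-pts zero)))
    (WeightedSum-of-Conv n (λ k → pts (suc k)) (λ k → w (suc k))
      (λ k → T-pts (suc k)) (λ k → 0≤w (suc k)))

  Conv-idem : Conv (Conv T) ⊆ Conv T
  Conv-idem x (n , pts , w , T-pts , 0≤w , Σw , x≈) =
    WeightedSum-resp Σw (λ j → sym (x≈ j)) (WeightedSum-of-Conv n pts w T-pts 0≤w)

  ⊆-Conv : T ⊆ Conv T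
  ⊆-Conv x Tx = 1 , (λ _ → x) , (λ _ → 1ℚ) , (λ _ → Tx) , (λ _ → nonNegative⁻¹ 1ℚ) ,
    +-identityʳ 1ℚ , λ j → sym (trans (+-identityʳ _) (*-identityˡ (x j)))

Conv-mono : ∀ {m} {S T : Subset m} → S ⊆ T → Conv S ⊆ Conv T
Conv-mono S⊆T x (n , pts , w , S-pts , rest) = n , pts , w , (λ k → S⊆T (pts k) (S-pts k)) , rest

Conv≐FreeSum : ∀ {m r} {S : Subset m} {T : Fin r → Subset m} →
  S ⊆ (λ x → ∃[ k ] T k x) → (∀ k → T k ⊆ S) → Conv S ≐ FreeSum (λ k → Conv (T k))
Conv≐FreeSum {m} {S = S} {T} S⊆⋃T T⊆S x =
  Conv-mono S⊆⋃Conv x , λ h → Conv-idem S x (Conv-mono ⋃Conv⊆Conv x h)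
  where
  ⋃Conv : Subset m
  ⋃Conv y = ∃[ k ] Conv (T k) y

  S⊆⋃Conv : S ⊆ ⋃Conv
  S⊆⋃Conv y Sy = let (k , Tky) = S⊆⋃T y Sy in k , ⊆-Conv (T k) y Tky

  ⋃Conv⊆Conv : ⋃Conv ⊆ Conv S
  ⋃Conv⊆Conv y (k , Tky) = Conv-mono (T⊆S k) y Tky

module _ {m : ℕ} {_≼_ : Fin m → Fin m → Set} (po : IsPartialOrder _≡_ _≼_) where
  open PosetPolytope _≼_

  ≺-isStrictPartialOrder : IsStrictPartialOrder _≡_ _≺_
  ≺-isStrictPartialOrder = ToStrict.<-isStrictPartialOrder _≡_ _≼_ po

  -- Whether i ≺ l is a cover is not decidable, so the chain of covers is only
  -- found under double negation (enough, since equality of labels is decidable).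
  ≺⇒¬¬Connected : ∀ {i l} → i ≺ l → ¬ ¬ Connected i l
  ≺⇒¬¬Connected {i} {l} i≺l ¬conn =
    ¬¬-excluded-middle λ d →
      go (spo-wellFounded ≺-isStrictPartialOrder l) (≻-wellFounded i) i≺l d ¬conn
    where
    ≻-wellFounded : WellFounded (flip _≺_)
    ≻-wellFounded = spo-wellFounded (Flip.isStrictPartialOrder ≺-isStrictPartialOrder)

    go : ∀ {i l} → Acc _≺_ l → Acc (flip _≺_) i → i ≺ l →
         Dec (∃[ x ] (i ≺ x × x ≺ l)) → ¬ ¬ Connected i l
    go {i} accˡ@(acc below-l) (acc above-i) _ (yes (x , i≺x , x≺l)) ¬conn =
      ¬¬-excluded-middle λ d → go (below-l x≺l) (≻-wellFounded i) i≺x d λ i~x →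
      ¬¬-excluded-middle λ d′ → go accˡ (above-i i≺x) x≺l d′ λ x~l → ¬conn (i~x ◅◅ x~l)
    go _ _ i≺l (no ∄x) ¬conn = ¬conn (return (tt , tt , i≺l , λ where
      bot    _ (() , _)
      (el x) _ (i≺x , x≺l) → ∄x (x , i≺x , x≺l)
      top    _ (_ , ())))

  ¬<̂bot : ∀ a → ¬ (a <̂ bot)
  ¬<̂bot bot    ()
  ¬<̂bot (el _) ()
  ¬<̂bot top    ()

  ¬top<̂ : ∀ b → ¬ (top <̂ b)
  ¬top<̂ _ ()

  InHat-⊤ : ∀ a → InHat (λ _ → ⊤) a
  InHat-⊤ bot    = tt
  InHat-⊤ (el _) = tt
  InHat-⊤ top    = tt

  Cover-restrict : ∀ {S a b} → Cover (λ _ → ⊤) a b → InHat S a → InHat S b → Cover S a b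
  Cover-restrict (_ , _ , a<b , ∄c) Sa Sb = Sa , Sb , a<b , λ c _ → ∄c c (InHat-⊤ c)

  Cover-extend : ∀ {S a b} → Cover S a b → (∀ l → a <̂ el l → el l <̂ b → S l) →
                 Cover (λ _ → ⊤) a b
  Cover-extend {a = a} {b} (_ , _ , a<b , ∄c) between = InHat-⊤ a , InHat-⊤ b , a<b , λ where
    bot    _ (a<bot , _) → ¬<̂bot a a<bot
    (el l) _ (a<l , l<b) → ∄c (el l) (between l a<l l<b) (a<l , l<b)
    top    _ (_ , top<b) → ¬top<̂ b top<b

  module _ {r : ℕ} (c : Fin m → Fin r) (c-resp : ∀ i j → Connected i j → c i ≡ c j) where

    Component : Fin r → Fin m → Set
    Component k i = c i ≡ k

    ≺⇒same-component : ∀ {i l} → i ≺ l → c i ≡ c l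
    ≺⇒same-component {i} {l} i≺l =
      decidable-stable (c i ≟ c l) (¬¬-map (c-resp i l) (≺⇒¬¬Connected i≺l))

    Gen⊆⋃Gen-Component : Gen (λ _ → ⊤) ⊆ (λ x → ∃[ k ] Gen (Component k) x)
    Gen⊆⋃Gen-Component x (el i , top , w , cov , ρ≡ , x≈) =
      c i , el i , top , w , Cover-restrict cov refl tt , ρ≡ , x≈
    Gen⊆⋃Gen-Component x (el i , el j , w , cov@(_ , _ , i≺j , _) , ρ≡ , x≈) =
      c i , el i , el j , w , Cover-restrict cov refl (sym (≺⇒same-component i≺j)) , ρ≡ , x≈
    Gen⊆⋃Gen-Component x (bot , el j , w , cov , ρ≡ , x≈) =
      c j , bot , el j , w , Cover-restrict cov tt refl , ρ≡ , x≈
    Gen⊆⋃Gen-Component x (bot , bot , _ , (_ , _ , () , _) , _)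
    Gen⊆⋃Gen-Component x (bot , top , _ , _ , () , _)
    Gen⊆⋃Gen-Component x (el _ , bot , _ , (_ , _ , () , _) , _)
    Gen⊆⋃Gen-Component x (top , _ , _ , (_ , _ , () , _) , _)

    Gen-Component⊆Gen : ∀ k → Gen (Component k) ⊆ Gen (λ _ → ⊤)
    Gen-Component⊆Gen k x (el i , b , w , cov@(ci≡k , _) , ρ≡ , x≈) =
      el i , b , w ,
      Cover-extend cov (λ l i≺l _ → trans (sym (≺⇒same-component i≺l)) ci≡k) , ρ≡ , x≈
    Gen-Component⊆Gen k x (bot , el j , w , cov@(_ , cj≡k , _) , ρ≡ , x≈) =
      bot , el j , w , Cover-extend cov (λ l _ l≺j → trans (≺⇒same-component l≺j) cj≡k) , ρ≡ , x≈
    Gen-Component⊆Gen k x (bot , bot , _ , (_ , _ , () , _) , _)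
    Gen-Component⊆Gen k x (bot , top , _ , _ , () , _)
    Gen-Component⊆Gen k x (top , _ , _ , (_ , _ , () , _) , _)

lemma3p5 : (m : ℕ) (_≼_ : Fin m → Fin m → Set) → IsPartialOrder _≡_ _≼_ →
    (r : ℕ) (c : Fin m → Fin r) → PosetPolytope.IsComponentLabelling _≼_ r c →
    PosetPolytope.H-P _≼_ ≐ FreeSum (λ k → PosetPolytope.H _≼_ (λ i → c i ≡ k))
lemma3p5 m _≼_ po r c (_ , c-iff) =
  Conv≐FreeSum (Gen⊆⋃Gen-Component po c c-resp) (Gen-Component⊆Gen po c c-resp)
  where
  c-resp : ∀ i j → PosetPolytope.Connected _≼_ i j → c i ≡ c j
  c-resp i j = proj₂ (c-iff i j)
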